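{- All demicaps in $AG(4,3)$ are affinely equivalent: for any two demicaps $D,D'$ there is an affine transformation $v\mapsto Av+b$ ($A\in GL(4,3)$, $b\in\mathbb{F}_3^4$) mapping $D$ onto $D'$.
   Context: $AG(4,3)=\mathbb{F}_3^4$ with lines the triples of distinct points $x,y,z$ with $x+y+z=0$. A cap is a set of points containing no line. A hyperplane is a 3-dimensional affine subspace. For a point $a$, an $a$-line is a pair $\{b,c\}$ with $\{a,b,c\}$ a line. A demicap with anchor point $a$ is a cap consisting of five $a$-lines such that no four of the corresponding lines through $a$ lie in a common hyperplane. -}

module Defs where

open import Data.Fin using (Fin; zero; suc; _≟_)
import Data.Nat as ℕ
open import Data.Vec using (Vec; lookup; tabulate; zipWith; replicate)
open import Data.Product using (Σ; ∃; _×_; _,_)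
open import Data.Sum using (_⊎_)
open import Relation.Binary.PropositionalEquality using (_≡_; _≢_)
open import Relation.Nullary using (¬_; yes; no)
open import Function.Definitions using (Injective)
open import Level using (0ℓ)
open import Relation.Unary using (Pred)

F3 : Set
F3 = Fin 3

infixl 6 _+₃_
infixl 7 _*₃_

_+₃_ : F3 → F3 → F3
zero +₃ y = y
suc zero +₃ zero = suc zero
suc zero +₃ suc zero = suc (suc zero)
suc zero +₃ suc (suc zero) = zero
suc (suc zero) +₃ zero = suc (suc zero)
suc (suc zero) +₃ suc zero = zero
suc (suc zero) +₃ suc (suc zero) = suc zero

_*₃_ : F3 → F3 → F3
zero *₃ y = zero
suc zero *₃ y = y
suc (suc zero) *₃ zero = zero
suc (suc zero) *₃ suc zero = suc (suc zero)
suc (suc zero) *₃ suc (suc zero) = suc zero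

-₃_ : F3 → F3
-₃ x = suc (suc zero) *₃ x

0₃ 1₃ : F3
0₃ = zero
1₃ = suc zero

Σ₃ : ∀ {n} → (Fin n → F3) → F3
Σ₃ {ℕ.zero} f = 0₃
Σ₃ {ℕ.suc n} f = f zero +₃ Σ₃ (λ i → f (suc i))

Point : Set
Point = Vec F3 4

0ᵖ : Point
0ᵖ = replicate 4 0₃

_⊕_ : Point → Point → Point
_⊕_ = zipWith _+₃_

_⊖_ : Point → Point → Point
x ⊖ y = zipWith (λ a b → a +₃ (-₃ b)) x y

_·_ : F3 → Point → Point
s · x = tabulate (λ i → s *₃ lookup x i)

IsLine : Point → Point → Point → Set
IsLine x y z = x ≢ y × y ≢ z × x ≢ z × (x ⊕ y) ⊕ z ≡ 0ᵖ

PointSet : Set₁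
PointSet = Pred Point 0ℓ

IsCap : PointSet → Set
IsCap S = ∀ x y z → S x → S y → S z → ¬ IsLine x y z

LinIndep3 : (Fin 3 → Point) → Set
LinIndep3 u = ∀ (s : Fin 3 → F3) →
  ((s zero · u zero) ⊕ (s (suc zero) · u (suc zero))) ⊕ (s (suc (suc zero)) · u (suc (suc zero))) ≡ 0ᵖ →
  ∀ i → s i ≡ 0₃

record Hyperplane : Set where
  constructor hyperplane
  field
    base : Point
    dir  : Fin 3 → Point
    indep : LinIndep3 dir

InHyperplane : Hyperplane → Point → Set
InHyperplane (hyperplane p u _) x =
  ∃ λ (s : Fin 3 → F3) →
    x ≡ ((p ⊕ (s zero · u zero)) ⊕ (s (suc zero) · u (suc zero))) ⊕ (s (suc (suc zero)) · u (suc (suc zero)))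

IsDemicapWithAnchor : Point → PointSet → Set
IsDemicapWithAnchor a D =
  IsCap D ×
  ∃ λ (b : Fin 5 → Point) → ∃ λ (c : Fin 5 → Point) →
    (∀ i → IsLine a (b i) (c i)) ×
    (∀ i j → i ≢ j → b i ≢ b j × b i ≢ c j) ×
    (∀ x → (D x → ∃ λ i → x ≡ b i ⊎ x ≡ c i) × ((∃ λ i → x ≡ b i ⊎ x ≡ c i) → D x)) ×
    (∀ (f : Fin 4 → Fin 5) → Injective _≡_ _≡_ f →
       ¬ (∃ λ (H : Hyperplane) → ∀ k →
            InHyperplane H a × InHyperplane H (b (f k)) × InHyperplane H (c (f k))))

IsDemicap : PointSet → Set
IsDemicap D = ∃ λ a → IsDemicapWithAnchor a D

Matrix : Set
Matrix = Fin 4 → Fin 4 → F3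

δ : Fin 4 → Fin 4 → F3
δ i j with i ≟ j
... | yes _ = 1₃
... | no _ = 0₃

_∘ₘ_ : Matrix → Matrix → Matrix
(A ∘ₘ B) i j = Σ₃ (λ k → A i k *₃ B k j)

IsInvertible : Matrix → Set
IsInvertible A = ∃ λ B → (∀ i j → (A ∘ₘ B) i j ≡ δ i j) × (∀ i j → (B ∘ₘ A) i j ≡ δ i j)

_▹_ : Matrix → Point → Point
A ▹ v = tabulate (λ i → Σ₃ (λ j → A i j *₃ lookup v j))

affine : Matrix → Point → Point → Point
affine A b v = (A ▹ v) ⊕ b

MapsOnto : (Point → Point) → PointSet → PointSet → Set
MapsOnto f S T = ∀ y → (T y → ∃ λ x → S x × f x ≡ y) × ((∃ λ x → S x × f x ≡ y) → T y)

-- A demicap D with anchor a is the union of five a-lines {a + dₘ, a − dₘ}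
-- (m = 0, …, 4). The hyperplane condition says that no nonzero linear form vanishes on four
-- of the directions dₘ; hence d₁, …, d₄ is a basis, and in d₀ = Σⱼ λⱼ dⱼ every λⱼ is nonzero,
-- for otherwise the j-th coordinate form of this basis would vanish on four directions.
-- The affine map x ↦ P x + a with P eⱼ = λⱼ dⱼ sends the standard demicap
-- {±e₁, …, ±e₄, ±(1,1,1,1)} onto D line by line, since {λ d, −λ d} = {d, −d} for λ ≠ 0.
-- Composing the map for D′ with the inverse of the one for D gives the equivalence.

module Submission where

open import Defs
open import Data.Product using (∃; _×_; _,_; proj₁; proj₂)
open import Data.Sum using (_⊎_; inj₁; inj₂; swap)
open import Data.Fin using (Fin; zero; suc; _≟_; punchIn; punchOut)
open import Data.Fin.Properties
  using (all?; any?; punchOut-injective; punchIn-injective; punchInᵢ≢i; suc-injective; injective⇒≤)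
import Data.Nat as ℕ
open import Data.Nat.Properties using (1+n≰n)
open import Data.Vec using ([]; _∷_; lookup; tabulate; zipWith; replicate)
open import Data.Vec.Properties
  using (lookup∘tabulate; tabulate∘lookup; tabulate-cong; lookup-zipWith; lookup-replicate; ≡-dec)
open import Data.Vec.Recursive using (fromVec; toVec; Fin[m^n]↔Fin[m]^n)
open import Data.Vec.Recursive.Properties using (fromVec∘toVec; toVec∘fromVec)
open import Data.Empty using (⊥-elim)
open import Function using (_∘_; id; _↔_; mk↔ₛ′; Inverse)
open import Function.Definitions using (Injective; StrictlySurjective)
open import Function.Properties.Inverse using (↔-trans; ↔-sym)
open import Relation.Binary.PropositionalEquality
open import Relation.Nullary using (¬_; Dec; yes; no; contradiction)
open import Relation.Nullary.Decidable using (from-yes; map′; _→-dec_; ¬?)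
open import Relation.Unary using (⋃; _≐_)
open import Relation.Unary.Properties using (≐-trans)

-- Arithmetic in F₃

+₃-identityʳ : ∀ x → x +₃ 0₃ ≡ x
+₃-identityʳ = from-yes (all? λ x → x +₃ 0₃ ≟ x)

+₃-interchange : ∀ x y z w → (x +₃ y) +₃ (z +₃ w) ≡ (x +₃ z) +₃ (y +₃ w)
+₃-interchange = from-yes (all? λ x → all? λ y → all? λ z → all? λ w →
  (x +₃ y) +₃ (z +₃ w) ≟ (x +₃ z) +₃ (y +₃ w))

*₃-assoc : ∀ x y z → (x *₃ y) *₃ z ≡ x *₃ (y *₃ z)
*₃-assoc = from-yes (all? λ x → all? λ y → all? λ z → (x *₃ y) *₃ z ≟ x *₃ (y *₃ z))

*₃-comm : ∀ x y → x *₃ y ≡ y *₃ x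
*₃-comm = from-yes (all? λ x → all? λ y → x *₃ y ≟ y *₃ x)

*₃-zeroʳ : ∀ x → x *₃ 0₃ ≡ 0₃
*₃-zeroʳ = from-yes (all? λ x → x *₃ 0₃ ≟ 0₃)

*₃-identityʳ : ∀ x → x *₃ 1₃ ≡ x
*₃-identityʳ = from-yes (all? λ x → x *₃ 1₃ ≟ x)

*₃-distribˡ-+₃ : ∀ x y z → x *₃ (y +₃ z) ≡ x *₃ y +₃ x *₃ z
*₃-distribˡ-+₃ = from-yes (all? λ x → all? λ y → all? λ z → x *₃ (y +₃ z) ≟ x *₃ y +₃ x *₃ z)

*₃-distribˡ-minus : ∀ x y z → x *₃ (y +₃ -₃ z) ≡ x *₃ y +₃ -₃ (x *₃ z)
*₃-distribˡ-minus = from-yes (all? λ x → all? λ y → all? λ z → x *₃ (y +₃ -₃ z) ≟ x *₃ y +₃ -₃ (x *₃ z))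

x*₃yz≡y*₃xz : ∀ x y z → x *₃ (y *₃ z) ≡ y *₃ (x *₃ z)
x*₃yz≡y*₃xz = from-yes (all? λ x → all? λ y → all? λ z → x *₃ (y *₃ z) ≟ y *₃ (x *₃ z))

+₃-inverseʳ : ∀ x → x +₃ -₃ x ≡ 0₃
+₃-inverseʳ = from-yes (all? λ x → x +₃ -₃ x ≟ 0₃)

*₃-cancelˡ : ∀ x y z → x ≢ 0₃ → x *₃ y ≡ x *₃ z → y ≡ z
*₃-cancelˡ = from-yes (all? λ x → all? λ y → all? λ z → ¬? (x ≟ 0₃) →-dec ((x *₃ y ≟ x *₃ z) →-dec (y ≟ z)))

-- Finite sums

Σ₃-cong : ∀ {n} {f g : Fin n → F3} → (∀ i → f i ≡ g i) → Σ₃ f ≡ Σ₃ g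
Σ₃-cong {ℕ.zero}  f≗g = refl
Σ₃-cong {ℕ.suc n} f≗g = cong₂ _+₃_ (f≗g zero) (Σ₃-cong (f≗g ∘ suc))

Σ₃-zero : ∀ {n} → Σ₃ {n} (λ _ → 0₃) ≡ 0₃
Σ₃-zero {ℕ.zero}  = refl
Σ₃-zero {ℕ.suc n} = Σ₃-zero {n}

Σ₃-distrib-+₃ : ∀ {n} (f g : Fin n → F3) → Σ₃ (λ i → f i +₃ g i) ≡ Σ₃ f +₃ Σ₃ g
Σ₃-distrib-+₃ {ℕ.zero}  f g = refl
Σ₃-distrib-+₃ {ℕ.suc n} f g =
  trans (cong (f zero +₃ g zero +₃_) (Σ₃-distrib-+₃ (f ∘ suc) (g ∘ suc)))
        (+₃-interchange (f zero) (g zero) (Σ₃ (f ∘ suc)) (Σ₃ (g ∘ suc)))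

*₃-distribˡ-Σ₃ : ∀ {n} x (f : Fin n → F3) → x *₃ Σ₃ f ≡ Σ₃ (λ i → x *₃ f i)
*₃-distribˡ-Σ₃ {ℕ.zero}  x f = *₃-zeroʳ x
*₃-distribˡ-Σ₃ {ℕ.suc n} x f =
  trans (*₃-distribˡ-+₃ x (f zero) (Σ₃ (f ∘ suc))) (cong (x *₃ f zero +₃_) (*₃-distribˡ-Σ₃ x (f ∘ suc)))

*₃-distribʳ-Σ₃ : ∀ {n} x (f : Fin n → F3) → Σ₃ f *₃ x ≡ Σ₃ (λ i → f i *₃ x)
*₃-distribʳ-Σ₃ x f =
  trans (*₃-comm (Σ₃ f) x) (trans (*₃-distribˡ-Σ₃ x f) (Σ₃-cong λ i → *₃-comm x (f i)))

Σ₃-comm : ∀ {m n} (f : Fin m → Fin n → F3) → Σ₃ (λ i → Σ₃ (f i)) ≡ Σ₃ (λ j → Σ₃ (λ i → f i j))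
Σ₃-comm {ℕ.zero}  {n} f = sym (Σ₃-zero {n})
Σ₃-comm {ℕ.suc m} f =
  trans (cong (Σ₃ (f zero) +₃_) (Σ₃-comm (f ∘ suc)))
        (sym (Σ₃-distrib-+₃ (f zero) (λ j → Σ₃ (λ i → f (suc i) j))))

-1₃ : F3
-1₃ = -₃ 1₃

-ᵖ_ : Point → Point
-ᵖ v = -1₃ · v

∷-cong₄ : ∀ {x₀ x₁ x₂ x₃ y₀ y₁ y₂ y₃ : F3} → x₀ ≡ y₀ → x₁ ≡ y₁ → x₂ ≡ y₂ → x₃ ≡ y₃ →
          (x₀ ∷ x₁ ∷ x₂ ∷ x₃ ∷ []) ≡ (y₀ ∷ y₁ ∷ y₂ ∷ y₃ ∷ [])
∷-cong₄ refl refl refl refl = refl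

∷-injective₄ : ∀ {x₀ x₁ x₂ x₃ y₀ y₁ y₂ y₃ : F3} → (x₀ ∷ x₁ ∷ x₂ ∷ x₃ ∷ []) ≡ (y₀ ∷ y₁ ∷ y₂ ∷ y₃ ∷ []) →
               x₀ ≡ y₀ × x₁ ≡ y₁ × x₂ ≡ y₂ × x₃ ≡ y₃
∷-injective₄ refl = refl , refl , refl , refl

≗⇒≡ : ∀ {u v : Point} → (∀ k → lookup u k ≡ lookup v k) → u ≡ v
≗⇒≡ {u} {v} u≗v = trans (sym (tabulate∘lookup u)) (trans (tabulate-cong u≗v) (tabulate∘lookup v))

_≟ᵖ_ : (u v : Point) → Dec (u ≡ v)
_≟ᵖ_ = ≡-dec _≟_

·-identityˡ : ∀ v → 1₃ · v ≡ v
·-identityˡ = tabulate∘lookup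

-ᵖ-involutive : ∀ v → -ᵖ (-ᵖ v) ≡ v
-ᵖ-involutive (x₀ ∷ x₁ ∷ x₂ ∷ x₃ ∷ []) = ∷-cong₄ (fact x₀) (fact x₁) (fact x₂) (fact x₃)
  where
  fact : ∀ x → -1₃ *₃ (-1₃ *₃ x) ≡ x
  fact = from-yes (all? λ x → -1₃ *₃ (-1₃ *₃ x) ≟ x)

⊖-⊕-cancel : ∀ u v → (v ⊖ u) ⊕ u ≡ v
⊖-⊕-cancel (u₀ ∷ u₁ ∷ u₂ ∷ u₃ ∷ []) (v₀ ∷ v₁ ∷ v₂ ∷ v₃ ∷ []) =
  ∷-cong₄ (fact u₀ v₀) (fact u₁ v₁) (fact u₂ v₂) (fact u₃ v₃)
  where
  fact : ∀ x y → (y +₃ -₃ x) +₃ x ≡ y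
  fact = from-yes (all? λ x → all? λ y → (y +₃ -₃ x) +₃ x ≟ y)

⊖-self : ∀ v → v ⊖ v ≡ 0ᵖ
⊖-self (x₀ ∷ x₁ ∷ x₂ ∷ x₃ ∷ []) = ∷-cong₄ (+₃-inverseʳ x₀) (+₃-inverseʳ x₁) (+₃-inverseʳ x₂) (+₃-inverseʳ x₃)

⊖≡0⇒≡ : ∀ u v → u ⊖ v ≡ 0ᵖ → u ≡ v
⊖≡0⇒≡ (u₀ ∷ u₁ ∷ u₂ ∷ u₃ ∷ []) (v₀ ∷ v₁ ∷ v₂ ∷ v₃ ∷ []) eq with ∷-injective₄ eq
... | e₀ , e₁ , e₂ , e₃ = ∷-cong₄ (fact u₀ v₀ e₀) (fact u₁ v₁ e₁) (fact u₂ v₂ e₂) (fact u₃ v₃ e₃)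
  where
  fact : ∀ x y → x +₃ -₃ y ≡ 0₃ → x ≡ y
  fact = from-yes (all? λ x → all? λ y → (x +₃ -₃ y ≟ 0₃) →-dec (x ≟ y))

⊕-⊖-interchange : ∀ u v w → (u ⊕ w) ⊕ (v ⊖ w) ≡ u ⊕ v
⊕-⊖-interchange (u₀ ∷ u₁ ∷ u₂ ∷ u₃ ∷ []) (v₀ ∷ v₁ ∷ v₂ ∷ v₃ ∷ []) (w₀ ∷ w₁ ∷ w₂ ∷ w₃ ∷ []) =
  ∷-cong₄ (fact u₀ v₀ w₀) (fact u₁ v₁ w₁) (fact u₂ v₂ w₂) (fact u₃ v₃ w₃)
  where
  fact : ∀ x y z → (x +₃ z) +₃ (y +₃ -₃ z) ≡ x +₃ y
  fact = from-yes (all? λ x → all? λ y → all? λ z → (x +₃ z) +₃ (y +₃ -₃ z) ≟ x +₃ y)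

translate-span : ∀ x p u v w → x ⊖ p ≡ (u ⊕ v) ⊕ w → x ≡ ((p ⊕ u) ⊕ v) ⊕ w
translate-span (x₀ ∷ x₁ ∷ x₂ ∷ x₃ ∷ []) (p₀ ∷ p₁ ∷ p₂ ∷ p₃ ∷ []) (u₀ ∷ u₁ ∷ u₂ ∷ u₃ ∷ [])
               (v₀ ∷ v₁ ∷ v₂ ∷ v₃ ∷ []) (w₀ ∷ w₁ ∷ w₂ ∷ w₃ ∷ []) eq with ∷-injective₄ eq
... | e₀ , e₁ , e₂ , e₃ =
  ∷-cong₄ (fact x₀ p₀ u₀ v₀ w₀ e₀) (fact x₁ p₁ u₁ v₁ w₁ e₁) (fact x₂ p₂ u₂ v₂ w₂ e₂) (fact x₃ p₃ u₃ v₃ w₃ e₃)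
  where
  fact : ∀ x p u v w → x +₃ -₃ p ≡ (u +₃ v) +₃ w → x ≡ ((p +₃ u) +₃ v) +₃ w
  fact = from-yes (all? λ x → all? λ p → all? λ u → all? λ v → all? λ w →
    (x +₃ -₃ p ≟ (u +₃ v) +₃ w) →-dec (x ≟ ((p +₃ u) +₃ v) +₃ w))

line-directions-opposite : ∀ a b c → (a ⊕ b) ⊕ c ≡ 0ᵖ → c ⊖ a ≡ -ᵖ (b ⊖ a)
line-directions-opposite (a₀ ∷ a₁ ∷ a₂ ∷ a₃ ∷ []) (b₀ ∷ b₁ ∷ b₂ ∷ b₃ ∷ []) (c₀ ∷ c₁ ∷ c₂ ∷ c₃ ∷ []) sum
  with ∷-injective₄ sum
... | e₀ , e₁ , e₂ , e₃ = ∷-cong₄ (fact a₀ b₀ c₀ e₀) (fact a₁ b₁ c₁ e₁) (fact a₂ b₂ c₂ e₂) (fact a₃ b₃ c₃ e₃)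
  where
  fact : ∀ x y z → (x +₃ y) +₃ z ≡ 0₃ → z +₃ -₃ x ≡ -1₃ *₃ (y +₃ -₃ x)
  fact = from-yes (all? λ x → all? λ y → all? λ z → ((x +₃ y) +₃ z ≟ 0₃) →-dec (z +₃ -₃ x ≟ -1₃ *₃ (y +₃ -₃ x)))

line-third-point : ∀ {a b c} → (a ⊕ b) ⊕ c ≡ 0ᵖ → (-ᵖ (b ⊖ a)) ⊕ a ≡ c
line-third-point {a} {b} {c} sum = trans (cong (_⊕ a) (sym (line-directions-opposite a b c sum))) (⊖-⊕-cancel a c)

-- Linear forms and matrices

dot : Point → Point → F3
dot u v = Σ₃ (λ k → lookup u k *₃ lookup v k)

lookup-⊕ : ∀ u v k → lookup (u ⊕ v) k ≡ lookup u k +₃ lookup v k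
lookup-⊕ u v k = lookup-zipWith _+₃_ k u v

lookup-⊖ : ∀ u v k → lookup (u ⊖ v) k ≡ lookup u k +₃ -₃ lookup v k
lookup-⊖ u v k = lookup-zipWith (λ x y → x +₃ -₃ y) k u v

lookup-· : ∀ s v k → lookup (s · v) k ≡ s *₃ lookup v k
lookup-· s v = lookup∘tabulate (λ i → s *₃ lookup v i)

dot-zeroˡ : ∀ v → dot 0ᵖ v ≡ 0₃
dot-zeroˡ v = trans (Σ₃-cong λ k → cong (_*₃ lookup v k) (lookup-replicate k 0₃)) (Σ₃-zero {4})

dot-comm : ∀ u v → dot u v ≡ dot v u
dot-comm u v = Σ₃-cong λ k → *₃-comm (lookup u k) (lookup v k)

dot-zeroʳ : ∀ φ → dot φ 0ᵖ ≡ 0₃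
dot-zeroʳ φ = trans (dot-comm φ 0ᵖ) (dot-zeroˡ φ)

dot-· : ∀ φ s v → dot φ (s · v) ≡ s *₃ dot φ v
dot-· φ s v = trans (Σ₃-cong λ k → trans (cong (lookup φ k *₃_) (lookup-· s v k))
                                         (x*₃yz≡y*₃xz (lookup φ k) s (lookup v k)))
                    (sym (*₃-distribˡ-Σ₃ s (λ k → lookup φ k *₃ lookup v k)))

-- -₃ x is 2 *₃ x by definition, so the last step is distributivity of 2 *₃_ over the sum.
dot-⊖ : ∀ φ u v → dot φ (u ⊖ v) ≡ dot φ u +₃ -₃ dot φ v
dot-⊖ φ u v = begin
  dot φ (u ⊖ v)
    ≡⟨ Σ₃-cong (λ k → trans (cong (lookup φ k *₃_) (lookup-⊖ u v k))
                            (*₃-distribˡ-minus (lookup φ k) (lookup u k) (lookup v k))) ⟩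
  Σ₃ (λ k → lookup φ k *₃ lookup u k +₃ -₃ (lookup φ k *₃ lookup v k))
    ≡⟨ Σ₃-distrib-+₃ (λ k → lookup φ k *₃ lookup u k) (λ k → -₃ (lookup φ k *₃ lookup v k)) ⟩
  dot φ u +₃ Σ₃ (λ k → -₃ (lookup φ k *₃ lookup v k))
    ≡⟨ cong (dot φ u +₃_) (sym (*₃-distribˡ-Σ₃ (-₃ 1₃) (λ k → lookup φ k *₃ lookup v k))) ⟩
  dot φ u +₃ -₃ dot φ v ∎
  where open ≡-Reasoning

lookup-▹ : ∀ A v i → lookup (A ▹ v) i ≡ Σ₃ (λ k → A i k *₃ lookup v k)
lookup-▹ A v = lookup∘tabulate (λ i → Σ₃ (λ k → A i k *₃ lookup v k))

▹-cong : ∀ {A B : Matrix} → (∀ i j → A i j ≡ B i j) → ∀ v → A ▹ v ≡ B ▹ v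
▹-cong A≗B v = tabulate-cong λ i → Σ₃-cong λ k → cong (_*₃ lookup v k) (A≗B i k)

▹-⊕ : ∀ A u v → A ▹ (u ⊕ v) ≡ (A ▹ u) ⊕ (A ▹ v)
▹-⊕ A u v = ≗⇒≡ λ i → begin
  lookup (A ▹ (u ⊕ v)) i
    ≡⟨ lookup-▹ A (u ⊕ v) i ⟩
  Σ₃ (λ k → A i k *₃ lookup (u ⊕ v) k)
    ≡⟨ Σ₃-cong (λ k → trans (cong (A i k *₃_) (lookup-⊕ u v k))
                            (*₃-distribˡ-+₃ (A i k) (lookup u k) (lookup v k))) ⟩
  Σ₃ (λ k → A i k *₃ lookup u k +₃ A i k *₃ lookup v k)
    ≡⟨ Σ₃-distrib-+₃ (λ k → A i k *₃ lookup u k) (λ k → A i k *₃ lookup v k) ⟩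
  Σ₃ (λ k → A i k *₃ lookup u k) +₃ Σ₃ (λ k → A i k *₃ lookup v k)
    ≡⟨ sym (cong₂ _+₃_ (lookup-▹ A u i) (lookup-▹ A v i)) ⟩
  lookup (A ▹ u) i +₃ lookup (A ▹ v) i
    ≡⟨ sym (lookup-⊕ (A ▹ u) (A ▹ v) i) ⟩
  lookup ((A ▹ u) ⊕ (A ▹ v)) i ∎
  where open ≡-Reasoning

▹-· : ∀ A s v → A ▹ (s · v) ≡ s · (A ▹ v)
▹-· A s v = ≗⇒≡ λ i → begin
  lookup (A ▹ (s · v)) i
    ≡⟨ lookup-▹ A (s · v) i ⟩
  Σ₃ (λ k → A i k *₃ lookup (s · v) k)
    ≡⟨ Σ₃-cong (λ k → trans (cong (A i k *₃_) (lookup-· s v k)) (x*₃yz≡y*₃xz (A i k) s (lookup v k))) ⟩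
  Σ₃ (λ k → s *₃ (A i k *₃ lookup v k))
    ≡⟨ sym (*₃-distribˡ-Σ₃ s (λ k → A i k *₃ lookup v k)) ⟩
  s *₃ Σ₃ (λ k → A i k *₃ lookup v k)
    ≡⟨ cong (s *₃_) (sym (lookup-▹ A v i)) ⟩
  s *₃ lookup (A ▹ v) i
    ≡⟨ sym (lookup-· s (A ▹ v) i) ⟩
  lookup (s · (A ▹ v)) i ∎
  where open ≡-Reasoning

▹-∘ : ∀ A B v → (A ∘ₘ B) ▹ v ≡ A ▹ (B ▹ v)
▹-∘ A B v = ≗⇒≡ λ i → begin
  lookup ((A ∘ₘ B) ▹ v) i
    ≡⟨ lookup-▹ (A ∘ₘ B) v i ⟩
  Σ₃ (λ j → Σ₃ (λ k → A i k *₃ B k j) *₃ lookup v j)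
    ≡⟨ Σ₃-cong (λ j → *₃-distribʳ-Σ₃ (lookup v j) (λ k → A i k *₃ B k j)) ⟩
  Σ₃ (λ j → Σ₃ (λ k → (A i k *₃ B k j) *₃ lookup v j))
    ≡⟨ Σ₃-comm (λ j k → (A i k *₃ B k j) *₃ lookup v j) ⟩
  Σ₃ (λ k → Σ₃ (λ j → (A i k *₃ B k j) *₃ lookup v j))
    ≡⟨ Σ₃-cong (λ k → trans (Σ₃-cong λ j → *₃-assoc (A i k) (B k j) (lookup v j))
                            (sym (*₃-distribˡ-Σ₃ (A i k) (λ j → B k j *₃ lookup v j)))) ⟩
  Σ₃ (λ k → A i k *₃ Σ₃ (λ j → B k j *₃ lookup v j))
    ≡⟨ Σ₃-cong (λ k → cong (A i k *₃_) (sym (lookup-▹ B v k))) ⟩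
  Σ₃ (λ k → A i k *₃ lookup (B ▹ v) k)
    ≡⟨ sym (lookup-▹ A (B ▹ v) i) ⟩
  lookup (A ▹ (B ▹ v)) i ∎
  where open ≡-Reasoning

δ-sym : ∀ i j → δ i j ≡ δ j i
δ-sym = from-yes (all? λ i → all? λ j → δ i j ≟ δ j i)

δ-diag : ∀ i → δ i i ≡ 1₃
δ-diag = from-yes (all? λ i → δ i i ≟ 1₃)

δ-off : ∀ i j → i ≢ j → δ i j ≡ 0₃
δ-off = from-yes (all? λ i → all? λ j → ¬? (i ≟ j) →-dec (δ i j ≟ 0₃))

Σ₃-δˡ : ∀ (g : Fin 4 → F3) i → Σ₃ (λ k → δ i k *₃ g k) ≡ g i
Σ₃-δˡ g zero                   = +₃-identityʳ (g zero)
Σ₃-δˡ g (suc zero)             = +₃-identityʳ (g (suc zero))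
Σ₃-δˡ g (suc (suc zero))       = +₃-identityʳ (g (suc (suc zero)))
Σ₃-δˡ g (suc (suc (suc zero))) = +₃-identityʳ (g (suc (suc (suc zero))))

Σ₃-δʳ : ∀ (g : Fin 4 → F3) j → Σ₃ (λ k → g k *₃ δ k j) ≡ g j
Σ₃-δʳ g j = trans (Σ₃-cong λ k → trans (*₃-comm (g k) (δ k j)) (cong (_*₃ g k) (δ-sym k j))) (Σ₃-δˡ g j)

▹-identity : ∀ v → δ ▹ v ≡ v
▹-identity v = ≗⇒≡ λ i → trans (lookup-▹ δ v i) (Σ₃-δˡ (lookup v) i)

col : Matrix → Fin 4 → Point
col A j = tabulate (λ k → A k j)

row : Matrix → Fin 4 → Point
row A i = tabulate (A i)

unit : Fin 4 → Point
unit = col δ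

▹-unit : ∀ A j → A ▹ unit j ≡ col A j
▹-unit A j = tabulate-cong λ i →
  trans (Σ₃-cong λ k → cong (A i k *₃_) (lookup∘tabulate (λ k → δ k j) k)) (Σ₃-δʳ (A i) j)

∘ₘ-col : ∀ A B i j → (A ∘ₘ B) i j ≡ lookup (A ▹ col B j) i
∘ₘ-col A B i j = sym (trans (lookup-▹ A (col B j) i)
                             (Σ₃-cong λ k → cong (A i k *₃_) (lookup∘tabulate (λ k → B k j) k)))

transpose : Matrix → Matrix
transpose A i j = A j i

_IsLeftInverseOf_ : Matrix → Matrix → Set
B IsLeftInverseOf A = ∀ i j → (B ∘ₘ A) i j ≡ δ i j

▹-inverse : ∀ {A B} → B IsLeftInverseOf A → ∀ v → B ▹ (A ▹ v) ≡ v
▹-inverse {A} {B} BA=I v = trans (sym (▹-∘ B A v)) (trans (▹-cong BA=I v) (▹-identity v))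

left-inverse⇒injective : ∀ {A B} → B IsLeftInverseOf A → Injective _≡_ _≡_ (A ▹_)
left-inverse⇒injective {A} {B} BA=I {u} {v} eq =
  trans (sym (▹-inverse {A} {B} BA=I u)) (trans (cong (B ▹_) eq) (▹-inverse {A} {B} BA=I v))

transpose-invertible : ∀ {A} → IsInvertible A → IsInvertible (transpose A)
transpose-invertible {A} (B , AB=I , BA=I) = transpose B , transposed {B} {A} BA=I , transposed {A} {B} AB=I
  where
  transposed : ∀ {X Y} → X IsLeftInverseOf Y → transpose Y IsLeftInverseOf transpose X
  transposed {X} {Y} XY=I i j = trans (Σ₃-cong λ k → *₃-comm (Y k i) (X j k)) (trans (XY=I j i) (δ-sym j i))

-- Invertibility of injective matrices

Point↔Fin81 : Point ↔ Fin 81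
Point↔Fin81 = ↔-trans (mk↔ₛ′ fromVec (toVec 4) (fromVec∘toVec 4) toVec∘fromVec)
                      (↔-sym (Fin[m^n]↔Fin[m]^n 3 4))

-- Opaque, so that type checking never runs the search for preimages.
opaque
  fin-injective⇒surjective : ∀ {n} {f : Fin n → Fin n} → Injective _≡_ _≡_ f → StrictlySurjective _≡_ f
  fin-injective⇒surjective {ℕ.suc n} {f} f-inj y with any? (λ x → f x ≟ y)
  ... | yes hit = hit
  ... | no miss = contradiction (injective⇒≤ missed-injective) 1+n≰n
    where
    missed : Fin (ℕ.suc n) → Fin n
    missed x = punchOut {i = y} (λ y≡fx → miss (x , sym y≡fx))
    missed-injective : Injective _≡_ _≡_ missed
    missed-injective eq = f-inj (punchOut-injective {i = y} _ _ eq)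

  injective⇒surjective : ∀ {n} {A : Set} → A ↔ Fin n → {f : A → A} →
                         Injective _≡_ _≡_ f → StrictlySurjective _≡_ f
  injective⇒surjective A↔Fin {f} f-inj y =
    let i , eq = fin-injective⇒surjective {f = to ∘ f ∘ from} (from-injective ∘ f-inj ∘ to-injective) (to y)
    in from i , to-injective eq
    where
    open Inverse A↔Fin
    to-injective : Injective _≡_ _≡_ to
    to-injective {x} {x′} eq = trans (sym (strictlyInverseʳ x)) (trans (cong from eq) (strictlyInverseʳ x′))
    from-injective : Injective _≡_ _≡_ from
    from-injective {i} {i′} eq = trans (sym (strictlyInverseˡ i)) (trans (cong to eq) (strictlyInverseˡ i′))

injective⇒invertible : ∀ A → Injective _≡_ _≡_ (A ▹_) → IsInvertible A
injective⇒invertible A A-inj = B , AB=I , BA=I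
  where
  preimage : ∀ j → ∃ λ x → A ▹ x ≡ unit j
  preimage j = injective⇒surjective Point↔Fin81 A-inj (unit j)

  B : Matrix
  B k j = lookup (proj₁ (preimage j)) k

  A▹colB : ∀ j → A ▹ col B j ≡ unit j
  A▹colB j = trans (cong (A ▹_) (tabulate∘lookup (proj₁ (preimage j)))) (proj₂ (preimage j))

  AB=I : A IsLeftInverseOf B
  AB=I i j = trans (∘ₘ-col A B i j)
                   (trans (cong (λ x → lookup x i) (A▹colB j)) (lookup∘tabulate (λ k → δ k j) i))

  B▹colA : ∀ j → B ▹ col A j ≡ unit j
  B▹colA j = A-inj (trans (▹-inverse {B} {A} AB=I (col A j)) (sym (▹-unit A j)))

  BA=I : B IsLeftInverseOf A
  BA=I i j = trans (∘ₘ-col B A i j)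
                   (trans (cong (λ x → lookup x i) (B▹colA j)) (lookup∘tabulate (λ k → δ k j) i))

-- Hyperplanes of linear forms

triple : ∀ {A : Set} → A → A → A → Fin 3 → A
triple x y z zero             = x
triple x y z (suc zero)       = y
triple x y z (suc (suc zero)) = z

span : (Fin 3 → Point) → (Fin 3 → F3) → Point
span u s = ((s zero · u zero) ⊕ (s (suc zero) · u (suc zero))) ⊕ (s (suc (suc zero)) · u (suc (suc zero)))

-- Solve φ · v = 0 for the first nonzero coordinate of φ, using x⁻¹ = x in F₃.
kernelBasis : Point → Fin 3 → Point
kernelBasis (suc x ∷ y ∷ z ∷ w ∷ []) =
  triple (-₃ (y *₃ suc x) ∷ 1₃ ∷ 0₃ ∷ 0₃ ∷ []) (-₃ (z *₃ suc x) ∷ 0₃ ∷ 1₃ ∷ 0₃ ∷ []) (-₃ (w *₃ suc x) ∷ 0₃ ∷ 0₃ ∷ 1₃ ∷ [])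
kernelBasis (zero ∷ suc y ∷ z ∷ w ∷ []) =
  triple (1₃ ∷ 0₃ ∷ 0₃ ∷ 0₃ ∷ []) (0₃ ∷ -₃ (z *₃ suc y) ∷ 1₃ ∷ 0₃ ∷ []) (0₃ ∷ -₃ (w *₃ suc y) ∷ 0₃ ∷ 1₃ ∷ [])
kernelBasis (zero ∷ zero ∷ suc z ∷ w ∷ []) =
  triple (1₃ ∷ 0₃ ∷ 0₃ ∷ 0₃ ∷ []) (0₃ ∷ 1₃ ∷ 0₃ ∷ 0₃ ∷ []) (0₃ ∷ 0₃ ∷ -₃ (w *₃ suc z) ∷ 1₃ ∷ [])
kernelBasis (zero ∷ zero ∷ zero ∷ w ∷ []) =
  triple (1₃ ∷ 0₃ ∷ 0₃ ∷ 0₃ ∷ []) (0₃ ∷ 1₃ ∷ 0₃ ∷ 0₃ ∷ []) (0₃ ∷ 0₃ ∷ 1₃ ∷ 0₃ ∷ [])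

all-points? : {P : Point → Set} → (∀ v → Dec (P v)) → Dec (∀ v → P v)
all-points? {P} P? = map′ (λ h → λ { (x ∷ y ∷ z ∷ w ∷ []) → h x y z w }) (λ h x y z w → h _)
  (all? λ x → all? λ y → all? λ z → all? λ w → P? (x ∷ y ∷ z ∷ w ∷ []))

InSpan : (Fin 3 → Point) → Point → Set
InSpan u v = ∃ λ s₀ → ∃ λ s₁ → ∃ λ s₂ → v ≡ span u (triple s₀ s₁ s₂)

-- Opaque, so that type checking never re-runs these exhaustive checks.
opaque
  kernelBasis-spans : ∀ φ → φ ≢ 0ᵖ → ∀ v → dot φ v ≡ 0₃ → InSpan (kernelBasis φ) v
  kernelBasis-spans = from-yes (all-points? λ φ → ¬? (φ ≟ᵖ 0ᵖ) →-dec all-points? λ v →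
    (dot φ v ≟ 0₃) →-dec (any? λ s₀ → any? λ s₁ → any? λ s₂ → v ≟ᵖ span (kernelBasis φ) (triple s₀ s₁ s₂)))

  kernelBasis-independent : ∀ φ → φ ≢ 0ᵖ → LinIndep3 (kernelBasis φ)
  kernelBasis-independent φ φ≢0 s span≡0 i =
    subst (_≡ 0₃) (triple-η i) (independent φ φ≢0 (s zero) (s (suc zero)) (s (suc (suc zero))) span≡0 i)
    where
    triple-η : ∀ i → triple (s zero) (s (suc zero)) (s (suc (suc zero))) i ≡ s i
    triple-η zero             = refl
    triple-η (suc zero)       = refl
    triple-η (suc (suc zero)) = refl

    independent : ∀ φ → φ ≢ 0ᵖ → ∀ s₀ s₁ s₂ → span (kernelBasis φ) (triple s₀ s₁ s₂) ≡ 0ᵖ →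
                  ∀ i → triple s₀ s₁ s₂ i ≡ 0₃
    independent = from-yes (all-points? λ φ → ¬? (φ ≟ᵖ 0ᵖ) →-dec all? λ s₀ → all? λ s₁ → all? λ s₂ →
      (span (kernelBasis φ) (triple s₀ s₁ s₂) ≟ᵖ 0ᵖ) →-dec all? λ i → triple s₀ s₁ s₂ i ≟ 0₃)

kernelHyperplane : (φ : Point) → φ ≢ 0ᵖ → Point → Hyperplane
kernelHyperplane φ φ≢0 a = hyperplane a (kernelBasis φ) (kernelBasis-independent φ φ≢0)

∈-kernelHyperplane : ∀ {φ} (φ≢0 : φ ≢ 0ᵖ) a x → dot φ (x ⊖ a) ≡ 0₃ → InHyperplane (kernelHyperplane φ φ≢0 a) x
∈-kernelHyperplane {φ} φ≢0 a x φ[x-a]≡0 =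
  let s₀ , s₁ , s₂ , x-a≡span = kernelBasis-spans φ φ≢0 (x ⊖ a) φ[x-a]≡0
  in triple s₀ s₁ s₂ , translate-span x a _ _ _ x-a≡span

line-⊆-kernelHyperplane : ∀ {φ} (φ≢0 : φ ≢ 0ᵖ) a b c → (a ⊕ b) ⊕ c ≡ 0ᵖ → dot φ (b ⊖ a) ≡ 0₃ →
  let H = kernelHyperplane φ φ≢0 a in InHyperplane H a × InHyperplane H b × InHyperplane H c
line-⊆-kernelHyperplane {φ} φ≢0 a b c sum φ[b-a]≡0 =
  ∈-kernelHyperplane φ≢0 a a (trans (cong (dot φ) (⊖-self a)) (dot-zeroʳ φ)) ,
  ∈-kernelHyperplane φ≢0 a b φ[b-a]≡0 ,
  ∈-kernelHyperplane φ≢0 a c (begin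
    dot φ (c ⊖ a)          ≡⟨ cong (dot φ) (line-directions-opposite a b c sum) ⟩
    dot φ (-ᵖ (b ⊖ a))     ≡⟨ dot-· φ -1₃ (b ⊖ a) ⟩
    -1₃ *₃ dot φ (b ⊖ a)   ≡⟨ cong (-1₃ *₃_) φ[b-a]≡0 ⟩
    0₃                     ∎)
  where open ≡-Reasoning

-- Affine images of point sets

Pair : Point → Point → PointSet
Pair u v x = x ≡ u ⊎ x ≡ v

Pair-comm : ∀ u v → Pair u v ≐ Pair v u
Pair-comm u v = swap , swap

Pair-cong : ∀ {u u′ v v′} → u ≡ u′ → v ≡ v′ → Pair u v ≐ Pair u′ v′
Pair-cong refl refl = id , id

line-pair : ∀ {a b c} μ → (a ⊕ b) ⊕ c ≡ 0ᵖ → μ ≢ 0₃ →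
            Pair ((μ · (b ⊖ a)) ⊕ a) ((-ᵖ (μ · (b ⊖ a))) ⊕ a) ≐ Pair b c
line-pair zero                   sum μ≢0 = contradiction refl μ≢0
line-pair {a} {b} {c} (suc zero) sum μ≢0 =
  Pair-cong (trans (cong (_⊕ a) (·-identityˡ (b ⊖ a))) (⊖-⊕-cancel a b))
            (trans (cong (λ v → (-ᵖ v) ⊕ a) (·-identityˡ (b ⊖ a))) (line-third-point sum))
-- Here μ is -1₃, so the two points come in the opposite order.
line-pair {a} {b} {c} (suc (suc zero)) sum μ≢0 =
  ≐-trans (Pair-cong (line-third-point sum) (trans (cong (_⊕ a) (-ᵖ-involutive (b ⊖ a))) (⊖-⊕-cancel a b)))
          (Pair-comm c b)

MapsOnto-pair : ∀ f u v → MapsOnto f (Pair u v) (Pair (f u) (f v))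
MapsOnto-pair f u v y = preimage , image
  where
  preimage : Pair (f u) (f v) y → ∃ λ x → Pair u v x × f x ≡ y
  preimage (inj₁ y≡fu) = u , inj₁ refl , sym y≡fu
  preimage (inj₂ y≡fv) = v , inj₂ refl , sym y≡fv
  image : (∃ λ x → Pair u v x × f x ≡ y) → Pair (f u) (f v) y
  image (x , inj₁ refl , refl) = inj₁ refl
  image (x , inj₂ refl , refl) = inj₂ refl

MapsOnto-⋃ : ∀ {I : Set} {f} {S T : I → PointSet} →
             (∀ i → MapsOnto f (S i) (T i)) → MapsOnto f (⋃ I S) (⋃ I T)
MapsOnto-⋃ {I} {f} {S} {T} onto y = preimage , image
  where
  preimage : ⋃ I T y → ∃ λ x → ⋃ I S x × f x ≡ y
  preimage (i , y∈Tᵢ) = let x , x∈Sᵢ , fx≡y = proj₁ (onto i y) y∈Tᵢ in x , (i , x∈Sᵢ) , fx≡y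
  image : (∃ λ x → ⋃ I S x × f x ≡ y) → ⋃ I T y
  image (x , (i , x∈Sᵢ) , fx≡y) = i , proj₂ (onto i y) (x , x∈Sᵢ , fx≡y)

MapsOnto-respʳ-≐ : ∀ {f S T T′} → T ≐ T′ → MapsOnto f S T → MapsOnto f S T′
MapsOnto-respʳ-≐ (T⊆T′ , T′⊆T) onto y =
  (λ y∈T′ → proj₁ (onto y) (T′⊆T y∈T′)) , (λ pre → T⊆T′ (proj₂ (onto y) pre))

MapsOnto-factor : ∀ {f g h S T U} → MapsOnto f S T → MapsOnto g S U → (∀ x → h (f x) ≡ g x) → MapsOnto h T U
MapsOnto-factor {f} {g} {h} {S} {T} {U} f-onto g-onto h∘f≗g y = preimage , image
  where
  preimage : U y → ∃ λ x → T x × h x ≡ y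
  preimage y∈U =
    let z , z∈S , gz≡y = proj₁ (g-onto y) y∈U
    in f z , proj₂ (f-onto (f z)) (z , z∈S , refl) , trans (h∘f≗g z) gz≡y
  image : (∃ λ x → T x × h x ≡ y) → U y
  image (x , x∈T , hx≡y) =
    let z , z∈S , fz≡x = proj₁ (f-onto x) x∈T
    in proj₂ (g-onto y) (z , z∈S , trans (sym (h∘f≗g z)) (trans (cong h fz≡x) hx≡y))

affine-factor : ∀ P p P′ p′ → IsInvertible P → IsInvertible P′ →
  ∃ λ A → ∃ λ b → IsInvertible A × (∀ x → affine A b (affine P p x) ≡ affine P′ p′ x)
affine-factor P p P′ p′ (Q , PQ=I , QP=I) (Q′ , _ , Q′P′=I) = A , p′ ⊖ (A ▹ p) , A-invertible , factor
  where
  A : Matrix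
  A = P′ ∘ₘ Q

  A-invertible : IsInvertible A
  A-invertible = injective⇒invertible A λ {u} {v} A▹u≡A▹v →
    left-inverse⇒injective {Q} {P} PQ=I (left-inverse⇒injective {P′} {Q′} Q′P′=I
      (trans (sym (▹-∘ P′ Q u)) (trans A▹u≡A▹v (▹-∘ P′ Q v))))

  factor : ∀ x → affine A (p′ ⊖ (A ▹ p)) (affine P p x) ≡ affine P′ p′ x
  factor x = begin
    (A ▹ ((P ▹ x) ⊕ p)) ⊕ (p′ ⊖ (A ▹ p))          ≡⟨ cong (_⊕ (p′ ⊖ (A ▹ p))) (▹-⊕ A (P ▹ x) p) ⟩
    ((A ▹ (P ▹ x)) ⊕ (A ▹ p)) ⊕ (p′ ⊖ (A ▹ p))    ≡⟨ ⊕-⊖-interchange (A ▹ (P ▹ x)) p′ (A ▹ p) ⟩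
    (A ▹ (P ▹ x)) ⊕ p′                             ≡⟨ cong (_⊕ p′) (▹-∘ P′ Q (P ▹ x)) ⟩
    (P′ ▹ (Q ▹ (P ▹ x))) ⊕ p′                      ≡⟨ cong (λ y → (P′ ▹ y) ⊕ p′) (▹-inverse {P} {Q} QP=I x) ⟩
    (P′ ▹ x) ⊕ p′                                  ∎
    where open ≡-Reasoning

affine-images-equivalent : ∀ {S D D′ : PointSet} {p p′} →
  (∃ λ P → IsInvertible P × MapsOnto (affine P p) S D) →
  (∃ λ P′ → IsInvertible P′ × MapsOnto (affine P′ p′) S D′) →
  ∃ λ A → ∃ λ b → IsInvertible A × MapsOnto (affine A b) D D′
affine-images-equivalent {p = p} {p′} (P , P-invertible , P↠D) (P′ , P′-invertible , P′↠D′) =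
  let A , b , A-invertible , A∘P≗P′ = affine-factor P p P′ p′ P-invertible P′-invertible
  in A , b , A-invertible , MapsOnto-factor P↠D P′↠D′ A∘P≗P′

-- Standard form of a demicap

standardDirection : Fin 5 → Point
standardDirection zero    = replicate 4 1₃
standardDirection (suc i) = unit i

StandardDemicap : PointSet
StandardDemicap = ⋃ (Fin 5) λ m → Pair (standardDirection m) (-ᵖ standardDirection m)

NoFourLinesInAHyperplane : Point → (Fin 5 → Point) → (Fin 5 → Point) → Set
NoFourLinesInAHyperplane a b c = ∀ (f : Fin 4 → Fin 5) → Injective _≡_ _≡_ f →
  ¬ (∃ λ (H : Hyperplane) → ∀ k → InHyperplane H a × InHyperplane H (b (f k)) × InHyperplane H (c (f k)))

module StandardForm (a : Point) (b c : Fin 5 → Point)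
                    (lines : ∀ m → (a ⊕ b m) ⊕ c m ≡ 0ᵖ)
                    (no-hyperplane : NoFourLinesInAHyperplane a b c) where

  d : Fin 5 → Point
  d m = b m ⊖ a

  annihilates-four⇒zero : (f : Fin 4 → Fin 5) → Injective _≡_ _≡_ f →
                         ∀ φ → (∀ k → dot φ (d (f k)) ≡ 0₃) → φ ≡ 0ᵖ
  annihilates-four⇒zero f f-inj φ φ⊥d with φ ≟ᵖ 0ᵖ
  ... | yes φ≡0 = φ≡0
  ... | no  φ≢0 = ⊥-elim (no-hyperplane f f-inj (kernelHyperplane φ φ≢0 a ,
                    λ k → line-⊆-kernelHyperplane φ≢0 a (b (f k)) (c (f k)) (lines (f k)) (φ⊥d k)))

  W : Matrix
  W i k = lookup (d (suc i)) k

  W-injective : Injective _≡_ _≡_ (W ▹_)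
  W-injective {u} {v} W▹u≡W▹v = ⊖≡0⇒≡ u v (annihilates-four⇒zero suc suc-injective (u ⊖ v) λ i → begin
    dot (u ⊖ v) (d (suc i))                      ≡⟨ dot-comm (u ⊖ v) (d (suc i)) ⟩
    dot (d (suc i)) (u ⊖ v)                      ≡⟨ dot-⊖ (d (suc i)) u v ⟩
    dot (d (suc i)) u +₃ -₃ dot (d (suc i)) v    ≡⟨ cong (λ x → x +₃ -₃ dot (d (suc i)) v) (same i) ⟩
    dot (d (suc i)) v +₃ -₃ dot (d (suc i)) v    ≡⟨ +₃-inverseʳ (dot (d (suc i)) v) ⟩
    0₃                                           ∎)
    where
    open ≡-Reasoning
    same : ∀ i → dot (d (suc i)) u ≡ dot (d (suc i)) v
    same i = trans (sym (lookup-▹ W u i)) (trans (cong (λ x → lookup x i) W▹u≡W▹v) (lookup-▹ W v i))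

  M : Matrix
  M = transpose W

  M-invertible : IsInvertible M
  M-invertible = transpose-invertible {W} (injective⇒invertible W W-injective)

  Q : Matrix
  Q = proj₁ M-invertible

  MQ=I : M IsLeftInverseOf Q
  MQ=I = proj₁ (proj₂ M-invertible)

  QM=I : Q IsLeftInverseOf M
  QM=I = proj₂ (proj₂ M-invertible)

  coeff : Point
  coeff = Q ▹ d zero

  M▹coeff : M ▹ coeff ≡ d zero
  M▹coeff = ▹-inverse {Q} {M} MQ=I (d zero)

  dot-row-Q : ∀ j i → dot (row Q j) (d (suc i)) ≡ δ j i
  dot-row-Q j i = trans (Σ₃-cong λ k → cong (_*₃ lookup (d (suc i)) k) (lookup∘tabulate (Q j) k)) (QM=I j i)

  dot-row-Q-zero : ∀ j → dot (row Q j) (d zero) ≡ lookup coeff j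
  dot-row-Q-zero j = trans (Σ₃-cong λ k → cong (_*₃ lookup (d zero) k) (lookup∘tabulate (Q j) k))
                           (sym (lookup-▹ Q (d zero) j))

  coeff-nonzero : ∀ j → lookup coeff j ≢ 0₃
  coeff-nonzero j coeffⱼ≡0 = 1≢0 (begin
    1₃                              ≡⟨ sym (δ-diag j) ⟩
    δ j j                           ≡⟨ sym (dot-row-Q j j) ⟩
    dot (row Q j) (d (suc j))       ≡⟨ cong (λ φ → dot φ (d (suc j))) rowⱼ≡0 ⟩
    dot 0ᵖ (d (suc j))              ≡⟨ dot-zeroˡ (d (suc j)) ⟩
    0₃                              ∎)
    where
    open ≡-Reasoning
    1≢0 : 1₃ ≢ 0₃
    1≢0 ()
    vanishes : ∀ m → m ≢ suc j → dot (row Q j) (d m) ≡ 0₃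
    vanishes zero    _     = trans (dot-row-Q-zero j) coeffⱼ≡0
    vanishes (suc i) i≢j   = trans (dot-row-Q j i) (δ-off j i (λ j≡i → i≢j (cong suc (sym j≡i))))
    rowⱼ≡0 : row Q j ≡ 0ᵖ
    rowⱼ≡0 = annihilates-four⇒zero (punchIn (suc j)) (punchIn-injective (suc j) _ _) (row Q j)
               λ k → vanishes (punchIn (suc j) k) (punchInᵢ≢i (suc j) k)

  P : Matrix
  P k i = M k i *₃ lookup coeff i

  P▹-factorises : ∀ u → P ▹ u ≡ M ▹ zipWith _*₃_ coeff u
  P▹-factorises u = tabulate-cong λ r → Σ₃-cong λ k →
    trans (*₃-assoc (M r k) (lookup coeff k) (lookup u k)) (cong (M r k *₃_) (sym (lookup-zipWith _*₃_ k coeff u)))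

  P-injective : Injective _≡_ _≡_ (P ▹_)
  P-injective {u} {v} P▹u≡P▹v = ≗⇒≡ λ k → *₃-cancelˡ (lookup coeff k) _ _ (coeff-nonzero k)
    (trans (sym (lookup-zipWith _*₃_ k coeff u))
           (trans (cong (λ x → lookup x k) coeff*u≡coeff*v) (lookup-zipWith _*₃_ k coeff v)))
    where
    coeff*u≡coeff*v : zipWith _*₃_ coeff u ≡ zipWith _*₃_ coeff v
    coeff*u≡coeff*v = left-inverse⇒injective {M} {Q} QM=I
                        (trans (sym (P▹-factorises u)) (trans P▹u≡P▹v (P▹-factorises v)))

  P-invertible : IsInvertible P
  P-invertible = injective⇒invertible P P-injective

  scale : Fin 5 → F3
  scale zero    = 1₃
  scale (suc i) = lookup coeff i

  scale-nonzero : ∀ m → scale m ≢ 0₃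
  scale-nonzero zero    ()
  scale-nonzero (suc i) = coeff-nonzero i

  P▹standardDirection : ∀ m → P ▹ standardDirection m ≡ scale m · d m
  P▹standardDirection zero = begin
    P ▹ replicate 4 1₃                       ≡⟨ P▹-factorises (replicate 4 1₃) ⟩
    M ▹ zipWith _*₃_ coeff (replicate 4 1₃)  ≡⟨ cong (M ▹_) coeff*ones ⟩
    M ▹ coeff                                ≡⟨ M▹coeff ⟩
    d zero                                   ≡⟨ sym (·-identityˡ (d zero)) ⟩
    1₃ · d zero                              ∎
    where
    open ≡-Reasoning
    coeff*ones : zipWith _*₃_ coeff (replicate 4 1₃) ≡ coeff
    coeff*ones = ≗⇒≡ λ k → begin
      lookup (zipWith _*₃_ coeff (replicate 4 1₃)) k   ≡⟨ lookup-zipWith _*₃_ k coeff (replicate 4 1₃) ⟩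
      lookup coeff k *₃ lookup (replicate 4 1₃) k     ≡⟨ cong (lookup coeff k *₃_) (lookup-replicate k 1₃) ⟩
      lookup coeff k *₃ 1₃                            ≡⟨ *₃-identityʳ (lookup coeff k) ⟩
      lookup coeff k                                  ∎
  P▹standardDirection (suc i) =
    trans (▹-unit P i) (tabulate-cong λ k → *₃-comm (lookup (d (suc i)) k) (lookup coeff i))

  line-image : ∀ m → MapsOnto (affine P a) (Pair (standardDirection m) (-ᵖ standardDirection m))
                                           (Pair (b m) (c m))
  line-image m = MapsOnto-respʳ-≐
    (≐-trans (Pair-cong (cong (_⊕ a) (P▹standardDirection m))
                        (cong (_⊕ a) (trans (▹-· P -1₃ (standardDirection m)) (cong -ᵖ_ (P▹standardDirection m)))))
             (line-pair (scale m) (lines m) (scale-nonzero m)))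
    (MapsOnto-pair (affine P a) (standardDirection m) (-ᵖ standardDirection m))

line-sum : ∀ {a b c} → IsLine a b c → (a ⊕ b) ⊕ c ≡ 0ᵖ
line-sum (_ , _ , _ , sum) = sum

demicap-standard-form : ∀ {a D} → IsDemicapWithAnchor a D →
                        ∃ λ P → IsInvertible P × MapsOnto (affine P a) StandardDemicap D
demicap-standard-form {a} {D} (_ , b , c , lines , _ , D-char , no-hyperplane) =
  P , P-invertible ,
  MapsOnto-respʳ-≐ ((λ {x} → proj₂ (D-char x)) , (λ {x} → proj₁ (D-char x))) (MapsOnto-⋃ line-image)
  where
  open StandardForm a b c (λ m → line-sum (lines m)) no-hyperplane

theorem3p6 : ∀ (D D′ : PointSet) → IsDemicap D → IsDemicap D′ →
    ∃ λ (A : Matrix) → ∃ λ (b : Point) → IsInvertible A × MapsOnto (affine A b) D D′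
theorem3p6 D D′ (a , D-demicap) (a′ , D′-demicap) =
  affine-images-equivalent (demicap-standard-form D-demicap) (demicap-standard-form D′-demicap)
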